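{- Let $n\ge3$ be odd and let $S$ be a cardioidal starter of order $n$. Then $S$ is strong if and only if $3\nmid n$.
   Context: A starter in $\mathbb{Z}_n$ ($n$ odd) is a partition of $\mathbb{Z}_n\setminus\{0\}$ into $(n-1)/2$ pairs $\{s_i,t_i\}$ such that the elements $\pm(s_i-t_i)$ are exactly the non-zero elements of $\mathbb{Z}_n$; it is strong if the sums $s_i+t_i$ are non-zero and pairwise distinct. A starter is cardioidal if every pair has the form $\{i,2i\bmod n\}$ for some $i\in\mathbb{Z}_n\setminus\{0\}$. -}

module Defs where

open import Data.Nat using (ℕ; zero; suc; _+_; _*_; _∸_; NonZero)
open import Data.Nat.DivMod using (_mod_)
open import Data.Fin using (Fin; toℕ)
open import Data.Bool using (Bool; true; false)
open import Data.Product using (Σ; ∃; _×_; _,_)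
open import Data.Sum using (_⊎_)
open import Relation.Binary.PropositionalEquality using (_≡_)
open import Relation.Nullary using (¬_)

Zn : ℕ → Set
Zn n = Fin n

module _ {n : ℕ} .{{_ : NonZero n}} where

  0ₙ : Zn n
  0ₙ = 0 mod n

  _⊕_ : Zn n → Zn n → Zn n
  a ⊕ b = (toℕ a + toℕ b) mod n

  ⊖_ : Zn n → Zn n
  ⊖ a = (n ∸ toℕ a) mod n

  _⊝_ : Zn n → Zn n → Zn n
  a ⊝ b = a ⊕ (⊖ b)

  dbl : Zn n → Zn n
  dbl a = (2 * toℕ a) mod n

  ExactlyNonzero : {k : ℕ} → (Fin k × Bool → Zn n) → Set
  ExactlyNonzero f =
    (∀ p → ¬ (f p ≡ 0ₙ)) ×
    (∀ p q → f p ≡ f q → p ≡ q) ×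
    (∀ x → ¬ (x ≡ 0ₙ) → ∃ λ p → f p ≡ x)

record Pairs (n k : ℕ) : Set where
  constructor pairs
  field
    s : Fin k → Zn n
    t : Fin k → Zn n

module _ {n : ℕ} .{{_ : NonZero n}} {k : ℕ} (P : Pairs n k) where
  open Pairs P

  entry : Fin k × Bool → Zn n
  entry (i , true)  = s i
  entry (i , false) = t i

  diff : Fin k × Bool → Zn n
  diff (i , true)  = s i ⊝ t i
  diff (i , false) = t i ⊝ s i

  -- starter: the pairs partition ℤ_n ∖ {0}, and the ±differences are
  -- exactly the non-zero elements of ℤ_n.  (Here k should be (n-1)/2.)
  IsStarter : Set
  IsStarter = ExactlyNonzero entry × ExactlyNonzero diff

  IsStrong : Set
  IsStrong = (∀ i → ¬ (s i ⊕ t i ≡ 0ₙ)) ×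
             (∀ i j → s i ⊕ t i ≡ s j ⊕ t j → i ≡ j)

  IsCardioidal : Set
  IsCardioidal = ∀ i → ∃ λ a → ¬ (a ≡ 0ₙ) ×
    ((s i ≡ a × t i ≡ dbl a) ⊎ (s i ≡ dbl a × t i ≡ a))

-- The pair {a, 2a} has sum 3a. If 3 ∤ n, multiplication by 3 is injective
-- on ℤ_n, so the sums are non-zero and pairwise distinct because the
-- elements a are. If n = 3q, then q lies in some pair {a, 2a}; since 3q = 0
-- and 2 is invertible modulo the odd n, in either case 3a = 0, so that pair
-- has sum 0.
module Submission where

open import Defs
open import Data.Nat using (ℕ; suc; z≤n; s≤s; _+_; _*_; _∸_; _%_; _≤_; _<_; NonZero; ∣_-_∣; ≢-nonZero; ≢-nonZero⁻¹)
open import Data.Nat.Properties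
open import Data.Nat.DivMod using (_/_; _mod_; m≡m%n+[m/n]*n; m%n<n; m<n⇒m%n≡m; n%n≡0; m%n%n≡m%n; %-distribˡ-+; %-distribˡ-*; %-remove-+ʳ)
open import Data.Nat.Divisibility using (_∣_; divides; ∣m+n∣m⇒∣n; ∣1⇒≡1)
open import Data.Nat.Coprimality using (Coprime; coprime-divisor)
open import Data.Nat.Primality using (Prime; prime[2]; prime?; prime⇒irreducible)
open import Data.Fin using (Fin; toℕ)
open import Data.Fin.Properties using (toℕ-fromℕ<; toℕ-injective; toℕ<n)
open import Data.Bool using (true; false)
open import Data.Product using (∃; _×_; _,_; proj₁; proj₂)
open import Data.Sum using (_⊎_; inj₁; inj₂)
open import Function.Base using (_∘_)
open import Function.Bundles using (_⇔_; mk⇔)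
open import Relation.Nullary using (¬_; contradiction)
open import Relation.Nullary.Decidable using (from-yes)
open import Relation.Binary.PropositionalEquality
open ≡-Reasoning

%≡%⇒∣∣-∣ : ∀ m n d .{{_ : NonZero d}} → m % d ≡ n % d → d ∣ ∣ m - n ∣
%≡%⇒∣∣-∣ m n d eq = divides ∣ m / d - n / d ∣ (begin
  ∣ m - n ∣
    ≡⟨ cong₂ ∣_-_∣ (m≡m%n+[m/n]*n m d)
                   (trans (m≡m%n+[m/n]*n n d) (cong (_+ n / d * d) (sym eq))) ⟩
  ∣ m % d + m / d * d - m % d + n / d * d ∣ ≡⟨ ∣m+n-m+o∣≡∣n-o∣ (m % d) _ _ ⟩
  ∣ m / d * d - n / d * d ∣                 ≡⟨ *-distribʳ-∣-∣ d (m / d) (n / d) ⟨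
  ∣ m / d - n / d ∣ * d                     ∎)

∣∸⇒%≡% : ∀ {m n} d .{{_ : NonZero d}} → n ≤ m → d ∣ m ∸ n → m % d ≡ n % d
∣∸⇒%≡% {m} {n} d n≤m d∣m∸n = begin
  m % d             ≡⟨ cong (_% d) (m+[n∸m]≡n n≤m) ⟨
  (n + (m ∸ n)) % d ≡⟨ %-remove-+ʳ n d∣m∸n ⟩
  n % d             ∎

∣∣-∣⇒%≡% : ∀ m n d .{{_ : NonZero d}} → d ∣ ∣ m - n ∣ → m % d ≡ n % d
∣∣-∣⇒%≡% m n d d∣ with ≤-total n m
... | inj₁ n≤m = ∣∸⇒%≡% d n≤m (subst (d ∣_) (m≤n⇒∣n-m∣≡n∸m n≤m) d∣)
... | inj₂ m≤n = sym (∣∸⇒%≡% d m≤n (subst (d ∣_) (m≤n⇒∣m-n∣≡n∸m m≤n) d∣))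

*-cancelˡ-% : ∀ {c} m n d .{{_ : NonZero d}} → Coprime d c →
              (c * m) % d ≡ (c * n) % d → m % d ≡ n % d
*-cancelˡ-% {c} m n d d⊥c eq = ∣∣-∣⇒%≡% m n d
  (coprime-divisor d⊥c (subst (d ∣_) (sym (*-distribˡ-∣-∣ c m n)) (%≡%⇒∣∣-∣ _ _ d eq)))

[m+n%d]%d≡[m+n]%d : ∀ m n d .{{_ : NonZero d}} → (m + n % d) % d ≡ (m + n) % d
[m+n%d]%d≡[m+n]%d m n d = begin
  (m + n % d) % d         ≡⟨ %-distribˡ-+ m (n % d) d ⟩
  (m % d + n % d % d) % d ≡⟨ cong (λ x → (m % d + x) % d) (m%n%n≡m%n n d) ⟩
  (m % d + n % d) % d     ≡⟨ %-distribˡ-+ m n d ⟨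
  (m + n) % d             ∎

[m*[n%d]]%d≡[m*n]%d : ∀ m n d .{{_ : NonZero d}} → (m * (n % d)) % d ≡ (m * n) % d
[m*[n%d]]%d≡[m*n]%d m n d = begin
  (m * (n % d)) % d       ≡⟨ %-distribˡ-* m (n % d) d ⟩
  (m % d * (n % d % d)) % d ≡⟨ cong (λ x → (m % d * x) % d) (m%n%n≡m%n n d) ⟩
  (m % d * (n % d)) % d   ≡⟨ %-distribˡ-* m n d ⟨
  (m * n) % d             ∎

prime∤⇒coprime : ∀ {p n} → Prime p → ¬ p ∣ n → Coprime n p
prime∤⇒coprime p-prime p∤n (d∣n , d∣p) with prime⇒irreducible p-prime d∣p
... | inj₁ d≡1 = d≡1
... | inj₂ refl = contradiction d∣n p∤n

prime[3] : Prime 3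
prime[3] = from-yes (prime? 3)

2∤1+k+k : ∀ k → ¬ 2 ∣ suc (k + k)
2∤1+k+k k 2∣1+k+k = contradiction (∣1⇒≡1 2∣1) λ ()
  where
  2∣k+k : 2 ∣ k + k
  2∣k+k = divides k (trans (cong (k +_) (sym (+-identityʳ k))) (*-comm 2 k))
  2∣1 : 2 ∣ 1
  2∣1 = ∣m+n∣m⇒∣n (subst (2 ∣_) (+-comm 1 (k + k)) 2∣1+k+k) 2∣k+k

module _ {n : ℕ} .{{_ : NonZero n}} where

  -- dbl a is definitionally 2 · a.
  infixr 7 _·_
  _·_ : ℕ → Zn n → Zn n
  c · a = (c * toℕ a) mod n

  toℕ-mod : ∀ m → toℕ (m mod n) ≡ m % n
  toℕ-mod m = toℕ-fromℕ< (m%n<n m n)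

  mod-cong : ∀ {m m′} → m % n ≡ m′ % n → m mod n ≡ m′ mod n
  mod-cong eq = toℕ-injective (trans (toℕ-mod _) (trans eq (sym (toℕ-mod _))))

  toℕ-0ₙ : toℕ (0ₙ {n}) ≡ 0
  toℕ-0ₙ = trans (toℕ-mod 0) (m<n⇒m%n≡m (n≢0⇒n>0 (≢-nonZero⁻¹ n)))

  ⊕-comm : (a b : Zn n) → a ⊕ b ≡ b ⊕ a
  ⊕-comm a b = cong (_mod n) (+-comm (toℕ a) (toℕ b))

  ⊕-dbl : (a : Zn n) → a ⊕ dbl a ≡ 3 · a
  ⊕-dbl a = mod-cong (begin
    (toℕ a + toℕ (2 · a)) % n     ≡⟨ cong (λ x → (toℕ a + x) % n) (toℕ-mod (2 * toℕ a)) ⟩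
    (toℕ a + (2 * toℕ a) % n) % n ≡⟨ [m+n%d]%d≡[m+n]%d (toℕ a) (2 * toℕ a) n ⟩
    (3 * toℕ a) % n               ∎)

  ·-·-assoc : ∀ c d (a : Zn n) → c · d · a ≡ (c * d) · a
  ·-·-assoc c d a = mod-cong (begin
    (c * toℕ (d · a)) % n      ≡⟨ cong (λ x → (c * x) % n) (toℕ-mod (d * toℕ a)) ⟩
    (c * ((d * toℕ a) % n)) % n ≡⟨ [m*[n%d]]%d≡[m*n]%d c (d * toℕ a) n ⟩
    (c * (d * toℕ a)) % n       ≡⟨ cong (_% n) (*-assoc c d (toℕ a)) ⟨
    (c * d * toℕ a) % n         ∎)

  ·-·-comm : ∀ c d (a : Zn n) → c · d · a ≡ d · c · a
  ·-·-comm c d a = begin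
    c · d · a   ≡⟨ ·-·-assoc c d a ⟩
    (c * d) · a ≡⟨ cong (_· a) (*-comm c d) ⟩
    (d * c) · a ≡⟨ ·-·-assoc d c a ⟨
    d · c · a   ∎

  ·-zeroʳ : ∀ c → c · 0ₙ ≡ 0ₙ
  ·-zeroʳ c = cong (_mod n) (trans (cong (c *_) toℕ-0ₙ) (*-zeroʳ c))

  ·-injective : ∀ {c} → Coprime n c → {a b : Zn n} → c · a ≡ c · b → a ≡ b
  ·-injective n⊥c {a} {b} eq = toℕ-injective (begin
    toℕ a     ≡⟨ m<n⇒m%n≡m (toℕ<n a) ⟨
    toℕ a % n ≡⟨ *-cancelˡ-% (toℕ a) (toℕ b) n n⊥c
                   (trans (sym (toℕ-mod _)) (trans (cong toℕ eq) (toℕ-mod _))) ⟩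
    toℕ b % n ≡⟨ m<n⇒m%n≡m (toℕ<n b) ⟩
    toℕ b     ∎)

  ·-zero-cancel : ∀ {m} c → Coprime n m → (a : Zn n) → c · m · a ≡ 0ₙ → c · a ≡ 0ₙ
  ·-zero-cancel {m} c n⊥m a cma≡0 = ·-injective n⊥m (begin
    m · c · a ≡⟨ ·-·-comm m c a ⟩
    c · m · a ≡⟨ cma≡0 ⟩
    0ₙ        ≡⟨ ·-zeroʳ m ⟨
    m · 0ₙ    ∎)

  ∣⇒zero-divisor : ∀ {d} → 1 < d → d ∣ n → ∃ λ x → x ≢ 0ₙ × d · x ≡ 0ₙ
  ∣⇒zero-divisor {d} 1<d (divides q n≡q*d) = q mod n , q≢0 ∘ toℕ-x≡0 , d·x≡0
    where
    q≢0 : q ≢ 0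
    q≢0 q≡0 = ≢-nonZero⁻¹ n (trans n≡q*d (cong (_* d) q≡0))
    q<n : q < n
    q<n = subst (q <_) (sym n≡q*d) (m<m*n q d 1<d)
      where instance _ = ≢-nonZero q≢0
    toℕ-x : toℕ (q mod n) ≡ q
    toℕ-x = trans (toℕ-mod q) (m<n⇒m%n≡m q<n)
    toℕ-x≡0 : q mod n ≡ 0ₙ → q ≡ 0
    toℕ-x≡0 x≡0 = trans (sym toℕ-x) (trans (cong toℕ x≡0) toℕ-0ₙ)
    d·x≡0 : d · (q mod n) ≡ 0ₙ
    d·x≡0 = mod-cong (begin
      (d * toℕ (q mod n)) % n ≡⟨ cong (λ x → (d * x) % n) toℕ-x ⟩
      (d * q) % n             ≡⟨ cong (_% n) (trans (*-comm d q) (sym n≡q*d)) ⟩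
      n % n                   ≡⟨ n%n≡0 n ⟩
      0                       ≡⟨ toℕ-0ₙ ⟨
      toℕ (0ₙ {n})            ≡⟨ toℕ-mod 0 ⟩
      0 % n                   ∎)

module Cardioidal {n k : ℕ} .{{_ : NonZero n}} {S : Pairs n k} (card : IsCardioidal S) where
  open Pairs S

  base : Fin k → Zn n
  base i = proj₁ (card i)

  base≢0 : ∀ i → base i ≢ 0ₙ
  base≢0 i = proj₁ (proj₂ (card i))

  sum≡3·base : ∀ i → s i ⊕ t i ≡ 3 · base i
  sum≡3·base i with proj₂ (proj₂ (card i))
  ... | inj₁ (s≡a , t≡2a) = trans (cong₂ _⊕_ s≡a t≡2a) (⊕-dbl (base i))
  ... | inj₂ (s≡2a , t≡a) =
    trans (cong₂ _⊕_ s≡2a t≡a) (trans (⊕-comm _ (base i)) (⊕-dbl (base i)))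

  base-entry : ∀ i → ∃ λ b → entry S (i , b) ≡ base i
  base-entry i with proj₂ (proj₂ (card i))
  ... | inj₁ (s≡a , _) = true , s≡a
  ... | inj₂ (_ , t≡a) = false , t≡a

  entry≡base⊎2·base : ∀ i b → entry S (i , b) ≡ base i ⊎ entry S (i , b) ≡ 2 · base i
  entry≡base⊎2·base i b with proj₂ (proj₂ (card i)) | b
  ... | inj₁ (s≡a , _)   | true  = inj₁ s≡a
  ... | inj₁ (_ , t≡2a)  | false = inj₂ t≡2a
  ... | inj₂ (s≡2a , _)  | true  = inj₂ s≡2a
  ... | inj₂ (_ , t≡a)   | false = inj₁ t≡a

  module _ (starter : IsStarter S) where

    base-injective : ∀ {i j} → base i ≡ base j → i ≡ j
    base-injective {i} {j} eq with base-entry i | base-entry j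
    ... | bᵢ , eᵢ | bⱼ , eⱼ =
      cong proj₁ (proj₁ (proj₂ (proj₁ starter)) (i , bᵢ) (j , bⱼ) (trans eᵢ (trans eq (sym eⱼ))))

    coprime⇒strong : Coprime n 3 → IsStrong S
    coprime⇒strong n⊥3 = sum≢0 , sum-injective
      where
      sum≢0 : ∀ i → s i ⊕ t i ≢ 0ₙ
      sum≢0 i sum≡0 = base≢0 i (·-injective n⊥3 (begin
        3 · base i ≡⟨ sum≡3·base i ⟨
        s i ⊕ t i  ≡⟨ sum≡0 ⟩
        0ₙ         ≡⟨ ·-zeroʳ 3 ⟨
        3 · 0ₙ     ∎))
      sum-injective : ∀ i j → s i ⊕ t i ≡ s j ⊕ t j → i ≡ j
      sum-injective i j eq = base-injective (·-injective n⊥3 (begin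
        3 · base i ≡⟨ sum≡3·base i ⟨
        s i ⊕ t i  ≡⟨ eq ⟩
        s j ⊕ t j  ≡⟨ sum≡3·base j ⟩
        3 · base j ∎))

    strong⇒3∤ : Coprime n 2 → IsStrong S → ¬ 3 ∣ n
    strong⇒3∤ n⊥2 (sum≢0 , _) 3∣n with ∣⇒zero-divisor (s≤s (s≤s z≤n)) 3∣n
    ... | x , x≢0 , 3x≡0 with proj₂ (proj₂ (proj₁ starter)) x x≢0
    ... | (i , b) , entry≡x = sum≢0 i (trans (sum≡3·base i) 3·base≡0)
      where
      3·base≡0 : 3 · base i ≡ 0ₙ
      3·base≡0 with entry≡base⊎2·base i b
      ... | inj₁ e = trans (cong (3 ·_) (trans (sym e) entry≡x)) 3x≡0
      ... | inj₂ e = ·-zero-cancel 3 n⊥2 (base i) (trans (cong (3 ·_) (trans (sym e) entry≡x)) 3x≡0)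

open Cardioidal

lemma3 : (k : ℕ) → 1 ≤ k → (S : Pairs (suc (k + k)) k) →
    IsStarter S → IsCardioidal S →
    (IsStrong S ⇔ (¬ (3 ∣ suc (k + k))))
lemma3 k _ S starter card = mk⇔
  (strong⇒3∤ card starter (prime∤⇒coprime prime[2] (2∤1+k+k k)))
  (coprime⇒strong card starter ∘ prime∤⇒coprime prime[3])
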